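{- Let $d\ge 1$ and let $X$ be a mutual-visibility set of the butterfly $\mathit{BF}(d)$. Then $|X\cap A_i|\le 2$ for every column index $i\in\{0,1\}^d$, where $A_i=\{[\ell,i] : \ell\in\{0,1,\dots,d\}\}$.
   Context: For a connected graph $G$ and $X\subseteq V(G)$, two vertices $x,y\in V(G)$ are $X$-visible if there is a shortest $x,y$-path none of whose internal vertices lies in $X$. $X$ is a mutual-visibility set if every two vertices of $X$ are $X$-visible. The $d$-dimensional butterfly $\mathit{BF}(d)$ has vertex set $\{[\ell,c] : \ell\in\{0,1,\dots,d\},\ c\in\{0,1\}^d\}$ ($\ell$ is the level, $c$ the column); for $\ell\in\{1,\dots,d\}$, the vertex $[\ell-1,c]$ is adjacent to $[\ell,c']$ if and only if either $c=c'$ or $c$ and $c'$ differ exactly in the $\ell$-th bit (bits counted from the left starting at 1); there are no other edges. -}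

module Defs where

open import Data.Nat using (ℕ; zero; suc; _≤_)
open import Data.Fin using (Fin; toℕ)
open import Data.Vec using (Vec; lookup; _[_]%=_)
open import Data.Bool using (Bool; true; false; not)
open import Data.List using (List; []; _∷_)
open import Data.List.Relation.Unary.All using (All)
open import Data.Product using (_×_; Σ; ∃; _,_)
open import Data.Sum using (_⊎_)
open import Relation.Binary.PropositionalEquality using (_≡_)

-- Vertex [ℓ , c] of BF(d): level ℓ ∈ {0..d}, column c ∈ {0,1}^d
-- (bits as Bool, vector position 0 = leftmost bit = "bit 1").
Vertex : ℕ → Set
Vertex d = Fin (suc d) × Vec Bool d

-- Directed description of an edge [ℓ-1,c] — [ℓ,c'] with ℓ = k+1, k : Fin d.
-- Bit ℓ (1-based from the left) is vector position k.
Edge : (d : ℕ) → Vertex d → Vertex d → Set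
Edge d (i , c) (j , c') =
  Σ (Fin d) λ k → (toℕ i ≡ toℕ k) × (toℕ j ≡ suc (toℕ k)) ×
    ((c' ≡ c) ⊎ (c' ≡ (c [ k ]%= not)))

Adj : (d : ℕ) → Vertex d → Vertex d → Set
Adj d u v = Edge d u v ⊎ Edge d v u

data Walk (d : ℕ) : Vertex d → Vertex d → ℕ → Set where
  here : ∀ {x} → Walk d x x 0
  step : ∀ {x y z n} → Adj d x y → Walk d y z n → Walk d x z (suc n)

inner : ∀ {d x y n} → Walk d x y n → List (Vertex d)
inner here = []
inner (step _ here) = []
inner (step {y = y} _ (step a w)) = y ∷ inner (step a w)

IsShortest : ∀ {d x y n} → Walk d x y n → Set
IsShortest {d} {x} {y} {n} _ = ∀ m → Walk d x y m → n ≤ m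

XVisible : (d : ℕ) → (Vertex d → Bool) → Vertex d → Vertex d → Set
XVisible d X x y =
  Σ ℕ λ n → Σ (Walk d x y n) λ w →
    IsShortest w × All (λ v → X v ≡ false) (inner w)

IsMutualVisibilitySet : (d : ℕ) → (Vertex d → Bool) → Set
IsMutualVisibilitySet d X =
  ∀ x y → X x ≡ true → X y ≡ true → XVisible d X x y

-- Every edge of BF(d) joins consecutive levels, and the edge between levels ℓ and ℓ + 1 can
-- only flip bit ℓ. Two vertices [a, i] and [c, i] of one column with a < c are at distance
-- c − a (walk straight up the column), so a shortest walk between them climbs one level per
-- step. Along such a walk bit ℓ is frozen once level ℓ + 1 is reached, and the bits above the
-- current level have not been touched yet; hence the walk enters every level b strictly
-- between a and c exactly at [b, i]. So a third vertex of X in the column would block it.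
module Submission where

open import Defs
open import Data.Nat using (ℕ; suc; _≤_)
open import Data.Fin using (Fin)
open import Data.Vec using (Vec)
open import Data.Bool using (Bool)
open import Data.List using (length; filter; allFin)
open import Data.Product using (_,_)
open import Relation.Binary.PropositionalEquality using (_≡_)
open import Data.Bool.Properties using (T?)

open import Data.Nat using (zero; _+_; _∸_; _<_; z≤n; s≤s)
open import Data.Nat.Properties
  using (+-suc; +-identityʳ; +-monoʳ-≤; n≤1+n; m+[n∸m]≡n; m+n≤o⇒m≤o; ≤-pred; m≤n⇒m≤1+n;
         ≤-antisym; ≤-reflexive; <-irrefl; <-trans; <⇒≢; <⇒≱; <⇒≤; ≤∧≢⇒<; module ≤-Reasoning)
  renaming (_≟_ to _≟ℕ_)
open import Data.Fin as Fin using (toℕ; fromℕ<)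
open import Data.Fin.Properties using (toℕ-injective; toℕ-fromℕ<; toℕ<n)
open import Data.Vec using (lookup; tabulate)
open import Data.Vec.Properties using (tabulate-cong; tabulate∘lookup; lookup∘updateAt′)
open import Data.Bool using (true; T)
open import Data.Bool.Properties using (not-¬; T-≡)
open import Function.Bundles using (Equivalence)
open import Data.List using (List; []; _∷_)
open import Data.List.Membership.Propositional using (_∈_)
open import Data.List.Relation.Unary.Any using (here; there)
open import Data.List.Relation.Unary.All as All using (All; []; _∷_)
open import Data.List.Relation.Unary.All.Properties using (all-filter)
open import Data.List.Relation.Unary.AllPairs using (AllPairs; []; _∷_)
open import Data.List.Relation.Unary.AllPairs.Properties as AllPairs using (tabulate⁺-<)
open import Data.Product using (proj₁; proj₂)
open import Data.Sum as Sum using (_⊎_; inj₁; inj₂)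
open import Data.Empty using (⊥; ⊥-elim)
open import Function using (id; _∘_)
open import Relation.Nullary using (Dec; yes; no)
open import Relation.Binary using (Rel)
open import Relation.Unary using (Pred)
open import Relation.Binary.PropositionalEquality
  using (_≢_; refl; sym; trans; cong; cong₂; subst; module ≡-Reasoning)

lookup-extensionality : ∀ {a} {A : Set a} {n} {u v : Vec A n} →
  (∀ p → lookup u p ≡ lookup v p) → u ≡ v
lookup-extensionality {u = u} {v} u≗v = begin
  u                    ≡⟨ sym (tabulate∘lookup u) ⟩
  tabulate (lookup u)  ≡⟨ tabulate-cong u≗v ⟩
  tabulate (lookup v)  ≡⟨ tabulate∘lookup v ⟩
  v                    ∎
  where open ≡-Reasoning

length≤2-without-chain₃ : ∀ {a r p} {A : Set a} {R : Rel A r} {P : Pred A p} {xs : List A} →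
  AllPairs R xs → All P xs →
  (∀ {x y z} → R x y → R y z → P x → P y → P z → ⊥) → length xs ≤ 2
length≤2-without-chain₃ {xs = []}            _ _ _ = z≤n
length≤2-without-chain₃ {xs = _ ∷ []}        _ _ _ = s≤s z≤n
length≤2-without-chain₃ {xs = _ ∷ _ ∷ []}    _ _ _ = s≤s (s≤s z≤n)
length≤2-without-chain₃ {xs = _ ∷ _ ∷ _ ∷ _}
  ((xRy ∷ _) ∷ (yRz ∷ _) ∷ _) (px ∷ py ∷ pz ∷ _) ¬chain = ⊥-elim (¬chain xRy yRz px py pz)

module _ {d : ℕ} where

  level : Vertex d → ℕ
  level = toℕ ∘ proj₁

  column : Vertex d → Vec Bool d
  column = proj₂

  Edge-level : ∀ {x y} → Edge d x y → level y ≡ suc (level x)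
  Edge-level (_ , x≡k , y≡1+k , _) = trans y≡1+k (cong suc (sym x≡k))

  Adj-level : ∀ {x y} → Adj d x y → level y ≡ suc (level x) ⊎ level x ≡ suc (level y)
  Adj-level = Sum.map Edge-level Edge-level

  Edge-lookup : ∀ {x y} → Edge d x y → ∀ p → toℕ p ≢ level x →
    lookup (column y) p ≡ lookup (column x) p
  Edge-lookup (k , x≡k , _ , inj₁ refl) p p≢x = refl
  Edge-lookup {x} (k , x≡k , _ , inj₂ refl) p p≢x =
    lookup∘updateAt′ p k (λ { refl → p≢x (sym x≡k) }) (column x)

  Walk-level-≤ : ∀ {x y n} → Walk d x y n → level y ≤ level x + n
  Walk-level-≤ {x} here = ≤-reflexive (sym (+-identityʳ (level x)))
  Walk-level-≤ {x} {y} {suc n} (step {y = z} e w) with Adj-level e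
  ... | inj₁ z≡1+x = begin
    level y            ≤⟨ Walk-level-≤ w ⟩
    level z + n        ≡⟨ cong (_+ n) z≡1+x ⟩
    suc (level x) + n  ≡⟨ sym (+-suc (level x) n) ⟩
    level x + suc n    ∎
    where open ≤-Reasoning
  ... | inj₂ x≡1+z = begin
    level y            ≤⟨ Walk-level-≤ w ⟩
    level z + n        ≤⟨ n≤1+n (level z + n) ⟩
    suc (level z) + n  ≡⟨ cong (_+ n) (sym x≡1+z) ⟩
    level x + n        ≤⟨ +-monoʳ-≤ (level x) (n≤1+n n) ⟩
    level x + suc n    ∎
    where open ≤-Reasoning

  Ascending : ∀ {x y n} → Walk d x y n → Set
  Ascending {x} {y} {n} _ = level y ≡ level x + n

  ascending-head : ∀ {x z y n} (e : Adj d x z) (w : Walk d z y n) →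
    Ascending (step e w) → Edge d x z
  ascending-head (inj₁ e) _ _ = e
  ascending-head {x} {z} {y} {n} (inj₂ e) w y≡x+1+n = ⊥-elim (<-irrefl y≡x+1+n y<x+1+n)
    where
      open ≤-Reasoning
      y<x+1+n : level y < level x + suc n
      y<x+1+n = begin-strict
        level y                  ≤⟨ Walk-level-≤ w ⟩
        level z + n              <⟨ s≤s (+-monoʳ-≤ (level z) (n≤1+n n)) ⟩
        suc (level z) + suc n    ≡⟨ cong (_+ suc n) (sym (Edge-level e)) ⟩
        level x + suc n          ∎

  ascending-tail : ∀ {x z y n} (e : Adj d x z) (w : Walk d z y n) →
    Ascending (step e w) → Ascending w
  ascending-tail {x} {z} {y} {n} e w y≡x+1+n = begin
    level y            ≡⟨ y≡x+1+n ⟩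
    level x + suc n    ≡⟨ +-suc (level x) n ⟩
    suc (level x) + n  ≡⟨ cong (_+ n) (sym (Edge-level (ascending-head e w y≡x+1+n))) ⟩
    level z + n        ∎
    where open ≡-Reasoning

  ascending-lookup-below : ∀ {x y n} (w : Walk d x y n) → Ascending w →
    ∀ p → toℕ p < level x → lookup (column y) p ≡ lookup (column x) p
  ascending-lookup-below here _ _ _ = refl
  ascending-lookup-below {x} {y} (step {y = z} e w) asc p p<x = begin
    lookup (column y) p  ≡⟨ ascending-lookup-below w (ascending-tail e w asc) p p<z ⟩
    lookup (column z) p  ≡⟨ Edge-lookup (ascending-head e w asc) p (<⇒≢ p<x) ⟩
    lookup (column x) p  ∎
    where
      open ≡-Reasoning
      p<z : toℕ p < level z
      p<z = subst (toℕ p <_) (sym (Edge-level (ascending-head e w asc))) (m≤n⇒m≤1+n p<x)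

  ascending-column-step : ∀ {x z y n} (e : Adj d x z) (w : Walk d z y n) →
    Ascending (step e w) → column x ≡ column y → column z ≡ column y
  ascending-column-step {x} {z} {y} e w asc x≡y = lookup-extensionality z≗y
    where
      z≡1+x : level z ≡ suc (level x)
      z≡1+x = Edge-level (ascending-head e w asc)
      z≗y : ∀ p → lookup (column z) p ≡ lookup (column y) p
      z≗y p with toℕ p ≟ℕ level x
      ... | yes p≡x = sym (ascending-lookup-below w (ascending-tail e w asc) p
                             (subst (_< level z) (sym p≡x) (≤-reflexive (sym z≡1+x))))
      ... | no p≢x = trans (Edge-lookup (ascending-head e w asc) p p≢x)
                           (cong (λ c → lookup c p) x≡y)

  ascending-visits-column : ∀ {x y n} (w : Walk d x y n) → Ascending w → column x ≡ column y →
    ∀ b → level x < toℕ b → toℕ b < level y → (b , column y) ∈ inner w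
  ascending-visits-column here _ _ b x<b b<x = ⊥-elim (<⇒≱ x<b (<⇒≤ b<x))
  ascending-visits-column (step e here) asc _ b x<b b<y =
    ⊥-elim (<⇒≱ x<b (≤-pred (subst (toℕ b <_) (Edge-level (ascending-head e here asc)) b<y)))
  ascending-visits-column {y = y} (step {y = z} e w@(step _ _)) asc x≡y b x<b b<y =
    -- The recursive call is handed to the helper as a continuation so that it is made on the
    -- subterm w itself, where the termination checker can see it.
    enter-or-pass (toℕ b ≟ℕ level z)
      (λ z<b → ascending-visits-column w (ascending-tail e w asc) z≡y b z<b b<y)
    where
      z≡y : column z ≡ column y
      z≡y = ascending-column-step e w asc x≡y
      enter-or-pass : Dec (toℕ b ≡ level z) →
        (level z < toℕ b → (b , column y) ∈ inner w) → (b , column y) ∈ z ∷ inner w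
      enter-or-pass (yes b≡z) _     = here (cong₂ _,_ (toℕ-injective b≡z) (sym z≡y))
      enter-or-pass (no b≢z)  later = there (later (≤∧≢⇒< z≤b (b≢z ∘ sym)))
        where
          z≤b : level z ≤ toℕ b
          z≤b = subst (_≤ toℕ b) (sym (Edge-level (ascending-head e w asc))) x<b

  vertical-walk : ∀ n {a b : Fin (suc d)} c → toℕ b ≡ toℕ a + n → Walk d (a , c) (b , c) n
  vertical-walk zero {a} c b≡a+0 with toℕ-injective (trans b≡a+0 (+-identityʳ (toℕ a)))
  ... | refl = here
  vertical-walk (suc n) {a} {b} c b≡a+1+n =
    step (inj₁ (k , sym (toℕ-fromℕ< a<d) , refl , inj₁ refl)) (vertical-walk n c b≡k+1+n)
    where
      a<d : toℕ a < d
      a<d = m+n≤o⇒m≤o (suc (toℕ a))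
              (subst (_≤ d) (trans b≡a+1+n (+-suc (toℕ a) n)) (≤-pred (toℕ<n b)))
      k : Fin d
      k = fromℕ< a<d
      b≡k+1+n : toℕ b ≡ suc (toℕ k) + n
      b≡k+1+n = begin
        toℕ b            ≡⟨ b≡a+1+n ⟩
        toℕ a + suc n    ≡⟨ +-suc (toℕ a) n ⟩
        suc (toℕ a) + n  ≡⟨ cong (λ m → suc m + n) (sym (toℕ-fromℕ< a<d)) ⟩
        suc (toℕ k) + n  ∎
        where open ≡-Reasoning

  shortest-vertical-ascending : ∀ {a b : Fin (suc d)} {c n} (w : Walk d (a , c) (b , c) n) →
    IsShortest w → a Fin.≤ b → Ascending w
  shortest-vertical-ascending {a} {b} {c} {n} w shortest a≤b = ≤-antisym (Walk-level-≤ w) (begin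
    toℕ a + n                ≤⟨ +-monoʳ-≤ (toℕ a) (shortest _ straight) ⟩
    toℕ a + (toℕ b ∸ toℕ a)  ≡⟨ m+[n∸m]≡n a≤b ⟩
    toℕ b                    ∎)
    where
      open ≤-Reasoning
      straight : Walk d (a , c) (b , c) (toℕ b ∸ toℕ a)
      straight = vertical-walk _ c (sym (m+[n∸m]≡n a≤b))

  no-column-triple-in-mutual-visibility-set : (X : Vertex d → Bool) → IsMutualVisibilitySet d X →
    ∀ c {a b b′} → a Fin.< b → b Fin.< b′ →
    X (a , c) ≡ true → X (b , c) ≡ true → X (b′ , c) ≡ true → ⊥
  no-column-triple-in-mutual-visibility-set X mv c {b = b} a<b b<b′ Xa Xb Xb′
    with mv (_ , c) (_ , c) Xa Xb′
  ... | _ , w , shortest , inner-free = not-¬ Xb (All.lookup inner-free b∈w)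
    where
      b∈w : (b , c) ∈ inner w
      b∈w = ascending-visits-column w
              (shortest-vertical-ascending w shortest (<⇒≤ (<-trans a<b b<b′)))
              refl _ a<b b<b′

lemma6 : (d : ℕ) → 1 ≤ d → (X : Vertex d → Bool) → IsMutualVisibilitySet d X →
    (i : Vec Bool d) →
      length (filter (λ ℓ → T? (X (ℓ , i))) (allFin (suc d))) ≤ 2
lemma6 d _ X mv i = length≤2-without-chain₃
  (AllPairs.filter⁺ keep (tabulate⁺-< id))
  (all-filter keep (allFin (suc d)))
  λ a<b b<c Xa Xb Xc →
    no-column-triple-in-mutual-visibility-set X mv i a<b b<c (T⇒≡ Xa) (T⇒≡ Xb) (T⇒≡ Xc)
  where
    keep : (ℓ : Fin (suc d)) → Dec (T (X (ℓ , i)))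
    keep ℓ = T? (X (ℓ , i))
    T⇒≡ : ∀ {b} → T b → b ≡ true
    T⇒≡ = Equivalence.to T-≡
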